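{- For all integers $i,j\geq 3$ with $i\neq j$ and $i\neq j+1$, the graph polynomials $\mathbf{P}^{ind}_{\mathcal{C}_i}$ and $\mathbf{P}^{ind}_{\mathcal{C}_j}$ are d.p.-incomparable, i.e., neither $\mathbf{P}^{ind}_{\mathcal{C}_i}\leq_{d.p.}\mathbf{P}^{ind}_{\mathcal{C}_j}$ nor $\mathbf{P}^{ind}_{\mathcal{C}_j}\leq_{d.p.}\mathbf{P}^{ind}_{\mathcal{C}_i}$. Hence there are infinitely many d.p.-inequivalent graph polynomials of the form $\mathbf{P}^{ind}_{\mathcal{C}}(G;X)$ with $\mathcal{C}$ a graph property.
   Context: All graphs are finite without multiple edges. $C_i$ is the cycle on $i$ vertices and $\mathcal{C}_i$ is the graph property consisting of all graphs isomorphic to $C_i$. For a graph property $\mathcal{C}$, $\mathbf{P}^{ind}_{\mathcal{C}}(G;X)=\sum_{A\subseteq V(G):G[A]\in\mathcal{C}}X^{|A|}$ with $G[A]$ the induced subgraph on $A$. $\mathbf{P}\leq_{d.p.}\mathbf{Q}$ means: for all graphs $G_1,G_2$, $\mathbf{Q}(G_1)=\mathbf{Q}(G_2)$ implies $\mathbf{P}(G_1)=\mathbf{P}(G_2)$. -}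

module Defs where

open import Data.Nat using (ℕ; zero; suc)
import Data.Nat as ℕ
open import Data.Bool using (Bool; true; false; not; _∧_; _∨_)
open import Data.Bool.Properties using (∨-comm)
open import Data.Fin using (Fin; toℕ) renaming (zero to fz; suc to fs)
import Data.Fin as F
open import Data.Fin.Subset using (Subset; inside; outside)
open import Data.Vec using ([]; _∷_)
open import Data.Product using (Σ; _×_; _,_)
open import Data.Empty using (⊥-elim)
open import Relation.Nullary using (¬_; yes; no)
open import Relation.Nullary.Decidable using (⌊_⌋)
open import Relation.Binary.PropositionalEquality
open import Function.Bundles using (_↔_; Inverse)
open import Function.Properties.Inverse using (↔-sym; ↔-trans)

record Graph (n : ℕ) : Set where
  field
    adj    : Fin n → Fin n → Bool
    adj-sym    : ∀ x y → adj x y ≡ adj y x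
    adj-irrefl : ∀ x → adj x x ≡ false
open Graph public

record _≅_ {n m : ℕ} (G : Graph n) (H : Graph m) : Set where
  field
    bij      : Fin n ↔ Fin m
    preserve : ∀ x y → adj G x y ≡ adj H (Inverse.to bij x) (Inverse.to bij y)
open _≅_ public

≅-sym : ∀ {n m} {G : Graph n} {H : Graph m} → G ≅ H → H ≅ G
≅-sym {G = G} {H} i = record { bij = ↔-sym (bij i) ; preserve = p }
  where
  open Inverse (bij i)
  p : ∀ x y → adj H x y ≡ adj G (from x) (from y)
  p x y = sym (trans (preserve i (from x) (from y))
                     (cong₂ (adj H) (strictlyInverseˡ x) (strictlyInverseˡ y)))

≅-trans : ∀ {n m k} {G : Graph n} {H : Graph m} {K : Graph k} →
          G ≅ H → H ≅ K → G ≅ K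
≅-trans i j = record
  { bij = ↔-trans (bij i) (bij j)
  ; preserve = λ x y → trans (preserve i x y) (preserve j _ _) }

record GraphProperty : Set₁ where
  field
    holds : ∀ {n} → Graph n → Set
    iso-invariant : ∀ {n m} {G : Graph n} {H : Graph m} → G ≅ H → holds G → holds H
open GraphProperty public

size : ∀ {n} → Subset n → ℕ
size []            = zero
size (true  ∷ A)   = suc (size A)
size (false ∷ A)   = size A

enum : ∀ {n} (A : Subset n) → Fin (size A) → Fin n
enum (true  ∷ A) fz     = fz
enum (true  ∷ A) (fs k) = fs (enum A k)
enum (false ∷ A) k      = fs (enum A k)

induced : ∀ {n} → Graph n → (A : Subset n) → Graph (size A)
induced G A = record
  { adj    = λ x y → adj G (enum A x) (enum A y)
  ; adj-sym    = λ x y → adj-sym G (enum A x) (enum A y)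
  ; adj-irrefl = λ x → adj-irrefl G (enum A x) }

-- The cycle C_i on vertices 0,…,i-1 : x ~ y iff y = x+1 mod i or x = y+1 mod i
-- (the guard x ≠ y only matters for i < 3 and keeps the graph loopless).

succMod : ℕ → ℕ → ℕ → Bool
succMod i a b = ⌊ suc a ℕ.≟ b ⌋ ∨ (⌊ suc a ℕ.≟ i ⌋ ∧ ⌊ b ℕ.≟ 0 ⌋)

cycAdj : (i : ℕ) → Fin i → Fin i → Bool
cycAdj i x y = not ⌊ x F.≟ y ⌋ ∧ (succMod i (toℕ x) (toℕ y) ∨ succMod i (toℕ y) (toℕ x))

Cycle : (i : ℕ) → Graph i
Cycle i = record { adj = cycAdj i ; adj-sym = s ; adj-irrefl = r }
  where
  r : ∀ x → cycAdj i x x ≡ false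
  r x with x F.≟ x
  ... | yes _ = refl
  ... | no ¬p = ⊥-elim (¬p refl)
  s : ∀ x y → cycAdj i x y ≡ cycAdj i y x
  s x y with x F.≟ y | y F.≟ x
  ... | yes _ | yes _ = refl
  ... | no _  | no _  = ∨-comm (succMod i (toℕ x) (toℕ y)) (succMod i (toℕ y) (toℕ x))
  ... | yes p | no ¬q = ⊥-elim (¬q (sym p))
  ... | no ¬p | yes q = ⊥-elim (¬p (sym q))

𝒞 : ℕ → GraphProperty
𝒞 i = record
  { holds = λ G → G ≅ Cycle i
  ; iso-invariant = λ G≅H G≅C → ≅-trans (≅-sym G≅H) G≅C }

-- The polynomial P^ind_𝒞(G;X) = Σ_{A ⊆ V(G), G[A] ∈ 𝒞} X^|A|.
-- Its coefficient of X^k is the number of elements of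
--   Coeff 𝒞 G k = { A ⊆ V(G) | |A| = k and G[A] ∈ 𝒞 }.
-- The membership proof is irrelevant, so Coeff is exactly that set of subsets.

record Coeff (C : GraphProperty) {n : ℕ} (G : Graph n) (k : ℕ) : Set where
  constructor ⟨_,_,_⟩
  field
    subset   : Subset n
    .sizeEq  : size subset ≡ k
    .inProp  : holds C (induced G subset)

-- Equality of the polynomials P^ind_𝒞(G₁;X) and P^ind_𝒞(G₂;X):
-- for every k, the coefficients of X^k coincide, i.e. the (finite) sets
-- counted by them are equinumerous.
PolyEq : GraphProperty → ∀ {n m} → Graph n → Graph m → Set
PolyEq C G₁ G₂ = ∀ k → Coeff C G₁ k ↔ Coeff C G₂ k

_≤dp_ : GraphProperty → GraphProperty → Set
C ≤dp D = ∀ {n m} (G₁ : Graph n) (G₂ : Graph m) → PolyEq D G₁ G₂ → PolyEq C G₁ G₂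

_≡dp_ : GraphProperty → GraphProperty → Set
C ≡dp D = (C ≤dp D) × (D ≤dp C)

module Submission where

open import Defs
open import Data.Nat using (ℕ; _≤_; suc)
open import Data.Fin using (Fin)
open import Data.Product using (_×_; Σ)
open import Relation.Nullary using (¬_)
open import Relation.Binary.PropositionalEquality using (_≡_; _≢_)

open import Data.Nat using (zero; _+_; _<_; s≤s)
import Data.Nat as ℕ
import Data.Nat.Properties as ℕP
open import Data.Bool using (true; false)
open import Data.Fin using (toℕ; fromℕ; fromℕ<; inject₁; lower₁) renaming (zero to fz; suc to fs)
import Data.Fin as F
import Data.Fin.Properties as FP
open import Data.Fin.Induction using (<-weakInduction; <-weakInduction-startingFrom)
open import Data.Fin.Subset using (Subset)
open import Data.Vec using ([]; _∷_)
open import Data.Product using (_,_; proj₁; proj₂; ∃)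
open import Data.Sum using (_⊎_; inj₁; inj₂)
open import Data.Empty using (⊥-elim; ⊥-elim-irr)
open import Relation.Nullary using (yes; no)
open import Relation.Binary.PropositionalEquality using (refl; sym; trans; cong; subst)
open import Function.Definitions using (Injective)
open import Function.Bundles using (_↔_; Inverse; Injection; mk↔ₛ′)
open import Function.Properties.Inverse using (↔⇒↣)

-- The heart of the matter is that the cycle C_i contains
-- no induced cycle C_j with 3 ≤ j other than itself: if G[A] ≅ C_j for
-- A ⊆ V(C_i), then every vertex of A has two distinct neighbours inside A;
-- since a vertex of C_i has only one cyclic predecessor, one of them is its
-- cyclic successor, so A is closed under "successor mod i" and hence A is all
-- of V(C_i), giving j = |A| = i.
-- Consequently, for i ≠ j (both ≥ 3), the cycle C_i and the graph with no
-- vertices have the same (zero) polynomial P^ind_{𝒞_j}, while P^ind_{𝒞_i}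
-- tells them apart (C_i itself contributes X^i); so 𝒞_i ≰_{d.p.} 𝒞_j.

Fin-bijective⇒≡ : ∀ {m n} {f : Fin m → Fin n} → Injective _≡_ _≡_ f →
                  (∀ y → ∃ λ x → f x ≡ y) → m ≡ n
Fin-bijective⇒≡ {f = f} f-inj f-surj =
  FP.cantor-schröder-bernstein f-inj section-injective
  where
  section-injective : Injective _≡_ _≡_ (λ y → proj₁ (f-surj y))
  section-injective {y₁} {y₂} e =
    trans (sym (proj₂ (f-surj y₁))) (trans (cong f e) (proj₂ (f-surj y₂)))

≅⇒≡ : ∀ {n m} {G : Graph n} {H : Graph m} → G ≅ H → n ≡ m
≅⇒≡ φ = Fin-bijective⇒≡ (Injection.injective (↔⇒↣ (bij φ)))
                        (λ y → from y , strictlyInverseˡ y)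
  where open Inverse (bij φ)

enum-injective : ∀ {n} (A : Subset n) → Injective _≡_ _≡_ (enum A)
enum-injective (true ∷ A) {fz}   {fz}   e = refl
enum-injective (true ∷ A) {fs k} {fs l} e = cong fs (enum-injective A (FP.suc-injective e))
enum-injective (false ∷ A)              e = enum-injective A (FP.suc-injective e)

_∈ᴱ_ : ∀ {n} → Fin n → Subset n → Set
v ∈ᴱ A = ∃ λ k → enum A k ≡ v

covering⇒size : ∀ {n} (A : Subset n) → (∀ v → v ∈ᴱ A) → size A ≡ n
covering⇒size A = Fin-bijective⇒≡ (enum-injective A)

full : ∀ n → Subset n
full zero    = []
full (suc n) = true ∷ full n

size-full : ∀ n → size (full n) ≡ n
size-full zero    = refl
size-full (suc n) = cong suc (size-full n)

induced-full : ∀ {n} (G : Graph n) → induced G (full n) ≅ G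
induced-full {n} G = record
  { bij      = mk↔ₛ′ (enum (full n)) position enum-position position-enum
  ; preserve = λ _ _ → refl }
  where
  position : ∀ {n} → Fin n → Fin (size (full n))
  position fz     = fz
  position (fs v) = fs (position v)
  enum-position : ∀ {n} (v : Fin n) → enum (full n) (position v) ≡ v
  enum-position fz     = refl
  enum-position (fs v) = cong fs (enum-position v)
  position-enum : ∀ {n} (k : Fin (size (full n))) → position (enum (full n) k) ≡ k
  position-enum {suc n} fz     = refl
  position-enum {suc n} (fs k) = cong fs (position-enum k)

Succ : ℕ → ℕ → ℕ → Set
Succ n x y = suc x ≡ y ⊎ (suc x ≡ n × y ≡ 0)

succMod⇒Succ : ∀ n x y → succMod n x y ≡ true → Succ n x y
succMod⇒Succ n x y e with suc x ℕ.≟ y | suc x ℕ.≟ n | y ℕ.≟ 0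
succMod⇒Succ n x y e  | yes p | _     | _     = inj₁ p
succMod⇒Succ n x y e  | no _  | yes p | yes q = inj₂ (p , q)
succMod⇒Succ n x y () | no _  | yes _ | no _
succMod⇒Succ n x y () | no _  | no _  | _

Succ⇒succMod : ∀ n x y → Succ n x y → succMod n x y ≡ true
Succ⇒succMod n x y s with suc x ℕ.≟ y | suc x ℕ.≟ n | y ℕ.≟ 0 | s
... | yes _ | _     | _     | _            = refl
... | no ¬p | _     | _     | inj₁ p       = ⊥-elim (¬p p)
... | no _  | yes _ | yes _ | inj₂ _       = refl
... | no _  | no ¬p | _     | inj₂ (p , _) = ⊥-elim (¬p p)
... | no _  | yes _ | no ¬q | inj₂ (_ , q) = ⊥-elim (¬q q)

Succ-irrefl : ∀ {n x} → 2 ≤ n → ¬ Succ n x x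
Succ-irrefl n≥2 (inj₁ p)             = ℕP.1+n≢n p
Succ-irrefl n≥2 (inj₂ (refl , refl)) = ℕP.<-irrefl refl n≥2

Succ-pred-unique : ∀ {n x₁ x₂ y} → Succ n x₁ y → Succ n x₂ y → x₁ ≡ x₂
Succ-pred-unique (inj₁ p)       (inj₁ q)       = ℕP.suc-injective (trans p (sym q))
Succ-pred-unique (inj₁ refl)    (inj₂ (_ , ()))
Succ-pred-unique (inj₂ (_ , ())) (inj₁ refl)
Succ-pred-unique (inj₂ (p , _)) (inj₂ (q , _)) = ℕP.suc-injective (trans p (sym q))

Succ-asym : ∀ {n x y} → 3 ≤ n → Succ n x y → ¬ Succ n y x
Succ-asym n≥3 (inj₁ refl) (inj₁ q) =
  ℕP.<⇒≢ (ℕP.m<n⇒m<1+n (ℕP.n<1+n _)) (sym q)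
Succ-asym (s≤s (s≤s ())) (inj₁ refl)          (inj₂ (refl , refl))
Succ-asym (s≤s (s≤s ())) (inj₂ (refl , refl)) (inj₁ refl)

cycAdj⇒Succ : ∀ n (x y : Fin n) → cycAdj n x y ≡ true →
              Succ n (toℕ x) (toℕ y) ⊎ Succ n (toℕ y) (toℕ x)
cycAdj⇒Succ n x y e
  with x F.≟ y | succMod n (toℕ x) (toℕ y) in xy | succMod n (toℕ y) (toℕ x) in yx
cycAdj⇒Succ n x y () | yes _ | _     | _
cycAdj⇒Succ n x y e  | no _  | true  | _     = inj₁ (succMod⇒Succ n _ _ xy)
cycAdj⇒Succ n x y e  | no _  | false | true  = inj₂ (succMod⇒Succ n _ _ yx)
cycAdj⇒Succ n x y () | no _  | false | false

Succ⇒cycAdj : ∀ {n} → 2 ≤ n → (x y : Fin n) → Succ n (toℕ x) (toℕ y) → cycAdj n x y ≡ true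
Succ⇒cycAdj {n} n≥2 x y s with x F.≟ y
... | yes refl = ⊥-elim (Succ-irrefl n≥2 s)
... | no _ rewrite Succ⇒succMod n _ _ s = refl

successor : ∀ {n} (x : Fin (suc n)) → ∃ λ (y : Fin (suc n)) → Succ (suc n) (toℕ x) (toℕ y)
successor {n} x with n ℕ.≟ toℕ x
... | yes n≡x = fz , inj₂ (cong suc (sym n≡x) , refl)
... | no  n≢x = fs (lower₁ x n≢x) , inj₁ (cong suc (sym (FP.toℕ-lower₁ x n≢x)))

predecessor : ∀ {n} (y : Fin (suc n)) → ∃ λ (x : Fin (suc n)) → Succ (suc n) (toℕ x) (toℕ y)
predecessor {n} fz     = fromℕ n , inj₂ (cong suc (FP.toℕ-fromℕ n) , refl)
predecessor {n} (fs y) = inject₁ y , inj₁ (cong suc (FP.toℕ-inject₁ y))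

two-neighbours : ∀ {n} → 3 ≤ n → (x : Fin n) →
                 ∃ λ y₁ → ∃ λ y₂ → y₁ ≢ y₂ × cycAdj n x y₁ ≡ true × cycAdj n x y₂ ≡ true
two-neighbours {suc n} n≥3 x with successor x | predecessor x
... | y₁ , x→y₁ | y₂ , y₂→x =
  y₁ , y₂ , (λ { refl → Succ-asym n≥3 x→y₁ y₂→x }) ,
  Succ⇒cycAdj n≥2 x y₁ x→y₁ ,
  trans (adj-sym (Cycle (suc n)) x y₂) (Succ⇒cycAdj n≥2 y₂ x y₂→x)
  where n≥2 = ℕP.≤-trans (ℕP.n≤1+n 2) n≥3

Succ-inject₁ : ∀ {n} (x : Fin n) (y : Fin (suc n)) →
               Succ (suc n) (toℕ (inject₁ x)) (toℕ y) → y ≡ fs x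
Succ-inject₁ x y (inj₁ p) =
  FP.toℕ-injective (trans (sym p) (cong suc (FP.toℕ-inject₁ x)))
Succ-inject₁ x y (inj₂ (p , _)) =
  ⊥-elim (ℕP.<⇒≢ (FP.toℕ<n x) (trans (sym (FP.toℕ-inject₁ x)) (ℕP.suc-injective p)))

Succ-fromℕ : ∀ {n} (y : Fin (suc n)) → Succ (suc n) (toℕ (fromℕ n)) (toℕ y) → y ≡ fz
Succ-fromℕ {n} y (inj₁ p) =
  ⊥-elim (ℕP.<⇒≢ (FP.toℕ<n y) (trans (sym p) (cong suc (FP.toℕ-fromℕ n))))
Succ-fromℕ y (inj₂ (_ , q)) = FP.toℕ-injective q

-- A set of vertices of C_n that is nonempty and in which every member has a
-- successor that is again a member contains every vertex: walk up to the top
-- vertex, wrap around to 0, and walk up again.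
successor-closed⇒total : ∀ {n} (P : Fin n → Set) →
                         (∀ x → P x → ∃ λ y → Succ n (toℕ x) (toℕ y) × P y) →
                         ∀ {x} → P x → ∀ y → P y
successor-closed⇒total {suc n} P step {x} Px = <-weakInduction P P0 advance
  where
  advance : ∀ z → P (inject₁ z) → P (fs z)
  advance z Pz with step _ Pz
  ... | y , z→y , Py = subst P (Succ-inject₁ z y z→y) Py
  Ptop : P (fromℕ n)
  Ptop = <-weakInduction-startingFrom P Px advance (FP.≤fromℕ x)
  P0 : P fz
  P0 with step _ Ptop
  ... | y , top→y , Py = subst P (Succ-fromℕ y top→y) Py

module InducedCycle {i j : ℕ} (j≥3 : 3 ≤ j) (A : Subset i)
                    (φ : induced (Cycle i) A ≅ Cycle j) where
  open Inverse (bij φ)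

  pull-adjacency : ∀ k y → cycAdj j (to k) y ≡ true → cycAdj i (enum A k) (enum A (from y)) ≡ true
  pull-adjacency k y e =
    trans (preserve φ k (from y)) (trans (cong (cycAdj j (to k)) (strictlyInverseˡ y)) e)

  two-neighbours-in-A : ∀ k → ∃ λ k₁ → ∃ λ k₂ → k₁ ≢ k₂ ×
    cycAdj i (enum A k) (enum A k₁) ≡ true × cycAdj i (enum A k) (enum A k₂) ≡ true
  two-neighbours-in-A k with two-neighbours j≥3 (to k)
  ... | y₁ , y₂ , y₁≢y₂ , a₁ , a₂ =
    from y₁ , from y₂ , (λ e → y₁≢y₂ (from-injective e)) ,
    pull-adjacency k y₁ a₁ , pull-adjacency k y₂ a₂
    where
    from-injective : ∀ {y z} → from y ≡ from z → y ≡ z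
    from-injective {y} {z} e =
      trans (sym (strictlyInverseˡ y)) (trans (cong to e) (strictlyInverseˡ z))

  -- Two distinct neighbours cannot both be predecessors, so every member of A
  -- has its successor in A.
  successor-in-A : ∀ v → v ∈ᴱ A → ∃ λ w → Succ i (toℕ v) (toℕ w) × w ∈ᴱ A
  successor-in-A v (k , refl) with two-neighbours-in-A k
  ... | k₁ , k₂ , k₁≢k₂ , a₁ , a₂ with cycAdj⇒Succ i _ _ a₁ | cycAdj⇒Succ i _ _ a₂
  ... | inj₁ v→w₁ | _          = enum A k₁ , v→w₁ , (k₁ , refl)
  ... | inj₂ _    | inj₁ v→w₂ = enum A k₂ , v→w₂ , (k₂ , refl)
  ... | inj₂ w₁→v | inj₂ w₂→v =
    ⊥-elim (k₁≢k₂ (enum-injective A (FP.toℕ-injective (Succ-pred-unique w₁→v w₂→v))))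

  -- A is nonempty: it contains the preimage of the vertex 2 of C_j.
  some-member : enum A (from (fromℕ< j≥3)) ∈ᴱ A
  some-member = _ , refl

  covers : ∀ v → v ∈ᴱ A
  covers = successor-closed⇒total (_∈ᴱ A) successor-in-A some-member

  i≡j : i ≡ j
  i≡j = trans (sym (covering⇒size A covers)) (≅⇒≡ φ)

induced-cycle⇒≡ : ∀ {i j} → 3 ≤ j → (A : Subset i) → induced (Cycle i) A ≅ Cycle j → i ≡ j
induced-cycle⇒≡ j≥3 A φ = InducedCycle.i≡j j≥3 A φ

Empty : Graph 0
Empty = record { adj = λ () ; adj-sym = λ () ; adj-irrefl = λ () }

no-cycle-in-Empty : ∀ {j k} → 0 < j → ¬ Coeff (𝒞 j) Empty k
no-cycle-in-Empty j>0 ⟨ [] , _ , φ ⟩ = ⊥-elim-irr (ℕP.<⇒≢ j>0 (≅⇒≡ φ))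

no-other-cycle-in-Cycle : ∀ {i j k} → 3 ≤ j → i ≢ j → ¬ Coeff (𝒞 j) (Cycle i) k
no-other-cycle-in-Cycle j≥3 i≢j ⟨ A , _ , φ ⟩ = ⊥-elim-irr (i≢j (induced-cycle⇒≡ j≥3 A φ))

Cycle-in-Cycle : ∀ i → Coeff (𝒞 i) (Cycle i) i
Cycle-in-Cycle i = ⟨ full i , size-full i , induced-full (Cycle i) ⟩

empty↔empty : ∀ {X Y : Set} → ¬ X → ¬ Y → X ↔ Y
empty↔empty ¬x ¬y = mk↔ₛ′ (λ x → ⊥-elim (¬x x)) (λ y → ⊥-elim (¬y y))
                          (λ y → ⊥-elim (¬y y)) (λ x → ⊥-elim (¬x x))

cycle-not-≤dp : ∀ {i j} → 0 < i → 3 ≤ j → i ≢ j → ¬ (𝒞 i ≤dp 𝒞 j)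
cycle-not-≤dp {i} i>0 j≥3 i≢j 𝒞i≤𝒞j =
  no-cycle-in-Empty i>0 (Inverse.to (𝒞i≤𝒞j (Cycle i) Empty same-𝒞j-poly i) (Cycle-in-Cycle i))
  where
  same-𝒞j-poly : PolyEq _ (Cycle i) Empty
  same-𝒞j-poly k =
    empty↔empty (no-other-cycle-in-Cycle j≥3 i≢j) (no-cycle-in-Empty (ℕP.m<n⇒0<n j≥3))

theorem12 : ((i j : ℕ) → 3 ≤ i → 3 ≤ j → i ≢ j → i ≢ suc j →
    ¬ (𝒞 i ≤dp 𝒞 j) × ¬ (𝒞 j ≤dp 𝒞 i))
    × ((N : ℕ) → Σ (Fin N → GraphProperty) (λ f →
    (a b : Fin N) → a ≢ b → ¬ (f a ≡dp f b)))
theorem12 = pairwise-incomparable , many-inequivalent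
  where
  pairwise-incomparable : (i j : ℕ) → 3 ≤ i → 3 ≤ j → i ≢ j → i ≢ suc j →
                          ¬ (𝒞 i ≤dp 𝒞 j) × ¬ (𝒞 j ≤dp 𝒞 i)
  pairwise-incomparable i j i≥3 j≥3 i≢j _ =
    cycle-not-≤dp (ℕP.m<n⇒0<n i≥3) j≥3 i≢j ,
    cycle-not-≤dp (ℕP.m<n⇒0<n j≥3) i≥3 (λ j≡i → i≢j (sym j≡i))

  many-inequivalent : (N : ℕ) → Σ (Fin N → GraphProperty) (λ f →
                      (a b : Fin N) → a ≢ b → ¬ (f a ≡dp f b))
  many-inequivalent N = (λ a → 𝒞 (3 + toℕ a)) , λ a b a≢b (≤ , _) →
    cycle-not-≤dp ℕP.0<1+n (ℕP.m≤m+n 3 _)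
      (λ e → a≢b (FP.toℕ-injective (ℕP.+-cancelˡ-≡ 3 _ _ e))) ≤
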